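{- For every integer $k\ge 3$, the cycle graph $C_{2k+1}$ is not permissible.
   Context: The MIS network of a graph $G=(V,E)$ is $F_G(x)_v=\bigwedge_{u\in N(v)}\neg x_u$ for $x\in\{0,1\}^V$; $F_G^v$ updates only coordinate $v$ to $F_G(x)_v$; for a word $w=w_1\dots w_l$, $F_G^w=F_G^{w_l}\circ\dots\circ F_G^{w_1}$. A permis of $G$ is a permutation $w$ of $V$ such that $F_G^w(x)$ is the characteristic vector of a maximal independent set of $G$ for every $x\in\{0,1\}^V$; $G$ is permissible if it has a permis. -}

module Defs where

open import Data.Bool using (Bool; true; false; _∧_; not)
open import Data.Nat using (ℕ; suc; _+_; _*_; _<_; _≤_)
open import Data.Nat.DivMod using (_%_)
open import Data.Fin using (Fin; toℕ; _≟_)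
open import Data.List using (List; foldl; allFin)
open import Data.List.Relation.Binary.Permutation.Propositional using (_↭_)
open import Data.Product using (Σ; _×_; ∃-syntax)
open import Data.Sum using (_⊎_)
open import Relation.Nullary.Decidable using (⌊_⌋)
open import Relation.Binary.PropositionalEquality using (_≡_)
open import Relation.Nullary using (¬_)

record Graph (n : ℕ) : Set where
  field
    adj   : Fin n → Fin n → Bool
    adj-sym    : ∀ u v → adj u v ≡ adj v u
    adj-irrefl : ∀ v → adj v v ≡ false
open Graph public

Config : ℕ → Set
Config n = Fin n → Bool

allL : {A : Set} → (A → Bool) → List A → Bool
allL p = foldl (λ b a → b ∧ p a) true

F : ∀ {n} → Graph n → Config n → Config n
F G x v = allL (λ u → not (adj G u v ∧ x u)) (allFin _)

Fv : ∀ {n} → Graph n → Fin n → Config n → Config n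
Fv G v x u with ⌊ u ≟ v ⌋
... | true  = F G x v
... | false = x u

Fw : ∀ {n} → Graph n → List (Fin n) → Config n → Config n
Fw G w x = foldl (λ y v → Fv G v y) x w

IsMIS : ∀ {n} → Graph n → Config n → Set
IsMIS G x =
  (∀ u v → adj G u v ≡ true → ¬ (x u ≡ true × x v ≡ true))
  × (∀ v → x v ≡ false → ∃[ u ] (adj G u v ≡ true × x u ≡ true))

IsPermis : ∀ {n} → Graph n → List (Fin n) → Set
IsPermis {n} G w = (w ↭ allFin n) × (∀ (x : Config n) → IsMIS G (Fw G w x))

Permissible : ∀ {n} → Graph n → Set
Permissible {n} G = Σ (List (Fin n)) (IsPermis G)

cycAdj : ∀ m → Fin (suc m) → Fin (suc m) → Bool
cycAdj m u v =
  ⌊ Data.Nat._≟_ (toℕ v) ((toℕ u + 1) % suc m) ⌋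
  Data.Bool.∨ ⌊ Data.Nat._≟_ (toℕ u) ((toℕ v + 1) % suc m) ⌋

open import Data.Bool.Properties using (∨-comm)
open import Data.Nat.Properties using (m≢1+n+m; ≤∧≢⇒<; +-comm)
open import Data.Nat.DivMod using (m<n⇒m%n≡m; n%n≡0)
open import Data.Fin.Properties using (toℕ<n)
open import Relation.Nullary using (yes; no)
open import Relation.Binary.PropositionalEquality using (refl; trans; sym; cong; subst)
open import Data.Empty using (⊥)

private
  noloop : ∀ m (v : Fin (suc (suc m))) → ¬ (toℕ v ≡ (toℕ v + 1) % suc (suc m))
  noloop m v eq with Data.Nat._≟_ (toℕ v + 1) (suc (suc m))
  ... | yes e = h (trans eq (trans (cong (_% suc (suc m)) e) (n%n≡0 (suc (suc m)))))
    where
      h : toℕ v ≡ 0 → ⊥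
      h z with trans (sym (cong (_+ 1) z)) e
      ... | ()
  ... | no ne = m≢1+n+m (toℕ v) {0} (trans eq (trans (m<n⇒m%n≡m lt) (+-comm (toℕ v) 1)))
    where
      lt : toℕ v + 1 < suc (suc m)
      lt = ≤∧≢⇒< (subst (_≤ suc (suc m)) (+-comm 1 (toℕ v)) (toℕ<n v)) ne

  dec-false : ∀ {P : Set} (d : Relation.Nullary.Dec P) → ¬ P → ⌊ d ⌋ ≡ false
  dec-false (yes p) np with np p
  ... | ()
  dec-false (no _) _ = refl

  cyc-irr : ∀ m v → cycAdj (suc m) v v ≡ false
  cyc-irr m v rewrite dec-false (Data.Nat._≟_ (toℕ v) ((toℕ v + 1) % suc (suc m))) (noloop m v) = refl

Cycle : ∀ m → Graph (suc (suc m))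
Cycle m = record { adj = cycAdj (suc m) ; adj-sym = λ u v → ∨-comm (⌊ Data.Nat._≟_ (toℕ v) ((toℕ u + 1) % suc (suc m)) ⌋) _ ; adj-irrefl = cyc-irr m }

{-# OPTIONS --safe #-}
-- Orient each edge {j, j + 1} of C_N by which end the permis w updates first, and let d j be true when
-- it is j. Started from all ones, a vertex updated before one of its neighbours reads a 1 there and ends
-- at 0, so no three consecutive vertices may each precede a neighbour. Where this alone does not forbid
-- two equal consecutive values of d, a start that is 1 except at the two neighbours of one vertex q does:
-- q keeps its 1 and kills the neighbour it precedes, the following vertices are killed by later
-- neighbours still holding their initial 1, and an undominated 0 remains. Both arguments use six
-- consecutive vertices, which are distinct once N ≥ 6. Hence d alternates, which is impossible around a
-- cycle of odd length.

module Submission where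

open import Defs
open import Data.Nat using (ℕ; zero; suc; _+_; _*_; _≤_; _<_; NonZero; _≤?_)
import Data.Nat as ℕ
open import Data.Nat.Properties
  using (+-comm; +-assoc; +-suc; +-identityʳ; *-suc; +-mono-≤; m≤n⇒m≤1+n; ≤-<-trans; <-irrefl)
open import Data.Nat.DivMod
  using (_%_; m%n<n; m%n%n≡m%n; [m+n]%n≡m%n; [m+kn]%n≡m%n; %-distribˡ-+; m<n⇒m%n≡m)
open import Data.Bool using (Bool; true; false; _∧_; _∨_; not; if_then_else_)
open import Data.Bool.Properties using (∧-zeroʳ; not-involutive; not-¬)
open import Data.Fin using (Fin; toℕ; fromℕ<; _≟_)
open import Data.Fin.Properties using (toℕ-injective; toℕ-fromℕ<; toℕ<n)
open import Data.List using (List; []; _∷_; foldl; allFin)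
open import Data.List.Properties using (foldl-cong)
open import Data.List.Membership.Propositional using (_∈_; _∉_)
open import Data.List.Membership.Propositional.Properties using (∈-allFin)
open import Data.List.Relation.Unary.Any using (here; there)
open import Data.List.Relation.Unary.All.Properties using (All¬⇒¬Any)
open import Data.List.Relation.Unary.AllPairs using (_∷_)
open import Data.List.Relation.Unary.Unique.Propositional using (Unique)
open import Data.List.Relation.Unary.Unique.Propositional.Properties using (allFin⁺)
open import Data.List.Relation.Binary.Permutation.Propositional using (_↭_; ↭-sym; ↭⇒↭ₛ)
open import Data.List.Relation.Binary.Permutation.Propositional.Properties using (∈-resp-↭)
open import Data.List.Relation.Binary.Permutation.Setoid.Properties using (Unique-resp-↭)
open import Data.Product using (_,_; proj₁; proj₂)
open import Data.Sum using (_⊎_; inj₁; inj₂)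
open import Data.Empty using (⊥; ⊥-elim)
open import Function using (_∘_; const)
open import Relation.Binary.PropositionalEquality
  using (_≡_; _≢_; refl; sym; trans; cong; cong₂; subst; _≗_; ≢-sym; setoid; module ≡-Reasoning)
open import Relation.Nullary using (¬_; Dec; yes; no; contradiction)
open import Relation.Nullary.Decidable using (⌊_⌋; True; toWitness)

open ≡-Reasoning

[m%n+k]%n≡[m+k]%n : ∀ m k n .{{_ : NonZero n}} → (m % n + k) % n ≡ (m + k) % n
[m%n+k]%n≡[m+k]%n m k n = begin
  (m % n + k) % n          ≡⟨ %-distribˡ-+ (m % n) k n ⟩
  (m % n % n + k % n) % n  ≡⟨ cong (λ r → (r + k % n) % n) (m%n%n≡m%n m n) ⟩
  (m % n + k % n) % n      ≡⟨ %-distribˡ-+ m k n ⟨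
  (m + k) % n              ∎

%-cancelʳ-+ : ∀ a b j n → (a + j) % suc n ≡ (b + j) % suc n → a % suc n ≡ b % suc n
%-cancelʳ-+ a b j n eq = begin
  a % suc n                        ≡⟨ undo-shift a ⟩
  ((a + j) % suc n + j * n) % suc n ≡⟨ cong (λ r → (r + j * n) % suc n) eq ⟩
  ((b + j) % suc n + j * n) % suc n ≡⟨ undo-shift b ⟨
  b % suc n                        ∎
  where
  undo-shift : ∀ c → c % suc n ≡ ((c + j) % suc n + j * n) % suc n
  undo-shift c = begin
    c % suc n                         ≡⟨ [m+kn]%n≡m%n c j (suc n) ⟨
    (c + j * suc n) % suc n           ≡⟨ cong (λ r → (c + r) % suc n) (*-suc j n) ⟩
    (c + (j + j * n)) % suc n         ≡⟨ cong (_% suc n) (+-assoc c j (j * n)) ⟨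
    (c + j + j * n) % suc n           ≡⟨ [m%n+k]%n≡[m+k]%n (c + j) (j * n) (suc n) ⟨
    ((c + j) % suc n + j * n) % suc n ∎

alternating-odd : ∀ {e : ℕ → Bool} → (∀ j → e (suc j) ≡ not (e j)) →
                  ∀ k → e (suc (k + k)) ≡ not (e 0)
alternating-odd alt zero = alt 0
alternating-odd {e} alt (suc k) = begin
  e (suc (suc (k + suc k)))        ≡⟨ cong (e ∘ suc ∘ suc) (+-suc k k) ⟩
  e (suc (suc (suc (k + k))))      ≡⟨ alt _ ⟩
  not (e (suc (suc (k + k))))      ≡⟨ cong not (alt _) ⟩
  not (not (e (suc (k + k))))      ≡⟨ not-involutive _ ⟩
  e (suc (k + k))                  ≡⟨ alternating-odd alt k ⟩
  not (e 0)                        ∎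

module _ {A : Set} {p : A → Bool} where

  allL-true : ∀ as → (∀ a → p a ≡ true) → allL p as ≡ true
  allL-true []       _   = refl
  allL-true (a ∷ as) p≡true rewrite p≡true a = allL-true as p≡true

  allL-false : ∀ {a as} → a ∈ as → p a ≡ false → allL p as ≡ false
  allL-false {a} a∈as pa≡false = from-accumulator true a∈as
    where
    stays-false : ∀ as → foldl (λ b x → b ∧ p x) false as ≡ false
    stays-false []       = refl
    stays-false (_ ∷ as) = stays-false as

    from-accumulator : ∀ b {as} → a ∈ as → foldl (λ b x → b ∧ p x) b as ≡ false
    from-accumulator b {_ ∷ as} (here refl) rewrite pa≡false | ∧-zeroʳ b = stays-false as
    from-accumulator b (there a∈as) = from-accumulator _ a∈as

before : ∀ {n} → List (Fin n) → Fin n → Fin n → Bool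
before []      u v = false
before (z ∷ w) u v with v ≟ z | u ≟ z
... | yes _ | _     = false
... | no _  | yes _ = true
... | no _  | no _  = before w u v

module _ {n} {u v : Fin n} where

  before-∉ : ∀ {w} → u ∉ w → before w u v ≡ false
  before-∉ {[]}    _   = refl
  before-∉ {z ∷ w} u∉ with v ≟ z | u ≟ z
  ... | yes _ | _       = refl
  ... | no _  | yes u≡z = contradiction (here u≡z) u∉
  ... | no _  | no _    = before-∉ {w} (u∉ ∘ there)

  before-asym : ∀ {w} → before w u v ≡ true → before w v u ≡ false
  before-asym {z ∷ w} u≺v with v ≟ z | u ≟ z | u≺v
  ... | yes _ | _     | ()
  ... | no _  | yes _ | _   = refl
  ... | no _  | no _  | u≺v = before-asym {w} u≺v

  before-cons : ∀ {z w} → v ≢ z → u ≢ z → before (z ∷ w) u v ≡ before w u v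
  before-cons {z} v≢z u≢z with v ≟ z | u ≟ z
  ... | yes v≡z | _       = contradiction v≡z v≢z
  ... | no _    | yes u≡z = contradiction u≡z u≢z
  ... | no _    | no _    = refl

  before-flip : ∀ {w} → u ≢ v → u ∈ w → before w u v ≡ not (before w v u)
  before-flip {z ∷ w} u≢v u∈ with v ≟ z | u ≟ z | u∈
  ... | yes refl | yes refl | _         = contradiction refl u≢v
  ... | yes _    | no _     | _         = refl
  ... | no _     | yes _    | _         = refl
  ... | no _     | no u≢z   | here u≡z  = contradiction u≡z u≢z
  ... | no _     | no _     | there u∈w = before-flip {w} u≢v u∈w

before-head : ∀ {n} {z v : Fin n} {w} → v ≢ z → before (z ∷ w) z v ≡ true
before-head {z = z} {v} v≢z with v ≟ z | z ≟ z
... | yes v≡z | _      = contradiction v≡z v≢z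
... | no _    | yes _  = refl
... | no _    | no z≢z = contradiction refl z≢z

module _ {n} (G : Graph n) where

  F-true : ∀ {y v} → (∀ u → adj G u v ≡ true → y u ≡ false) → F G y v ≡ true
  F-true {y} {v} neighbours-off = allL-true (allFin n) unblocked
    where
    unblocked : ∀ u → not (adj G u v ∧ y u) ≡ true
    unblocked u with adj G u v in uv
    ... | false = refl
    ... | true  rewrite neighbours-off u uv = refl

  F-false : ∀ {y u v} → adj G u v ≡ true → y u ≡ true → F G y v ≡ false
  F-false {u = u} uv yu = allL-false (∈-allFin u) (cong₂ (λ a b → not (a ∧ b)) uv yu)

  F-cong : ∀ {y y′} v → y ≗ y′ → F G y v ≡ F G y′ v
  F-cong v y≗y′ =
    foldl-cong (λ b u → cong (λ t → b ∧ not (adj G u v ∧ t)) (y≗y′ u)) true (allFin n)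

  Fv-self : ∀ v x → Fv G v x v ≡ F G x v
  Fv-self v x with v ≟ v
  ... | yes _   = refl
  ... | no v≢v  = contradiction refl v≢v

  Fv-other : ∀ {u v} x → u ≢ v → Fv G v x u ≡ x u
  Fv-other {u} {v} x u≢v with u ≟ v
  ... | yes u≡v = contradiction u≡v u≢v
  ... | no _    = refl

  Fw-∉ : ∀ {v} w x → v ∉ w → Fw G w x v ≡ x v
  Fw-∉ []      x _   = refl
  Fw-∉ (z ∷ w) x v∉ = trans (Fw-∉ w (Fv G z x) (v∉ ∘ there)) (Fv-other x (v∉ ∘ here))

  ¬IsMIS-undominated : ∀ {y v} → y v ≡ false → (∀ u → adj G u v ≡ true → y u ≡ false) →
                       ¬ IsMIS G y
  ¬IsMIS-undominated {v = v} yv≡false neighbours-off (_ , dominating)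
    with dominating v yv≡false
  ... | u , uv , yu≡true with trans (sym yu≡true) (neighbours-off u uv)
  ... | ()

  -- what v reads when it is updated: vertices before it in w already hold their final values
  seen : List (Fin n) → Config n → Fin n → Config n
  seen w x v u = if before w u v then Fw G w x u else x u

  seen-before : ∀ {w x u v} → before w u v ≡ true → seen w x v u ≡ Fw G w x u
  seen-before {w} {x} {u} u≺v = cong (λ b → if b then Fw G w x u else x u) u≺v

  seen-not-before : ∀ {w x u v} → before w u v ≡ false → seen w x v u ≡ x u
  seen-not-before {w} {x} {u} u⊀v = cong (λ b → if b then Fw G w x u else x u) u⊀v

  Fw-seen : ∀ {w v} → Unique w → v ∈ w → ∀ x → Fw G w x v ≡ F G (seen w x v) v
  Fw-seen {v ∷ w} {v} (v∉w ∷ _) (here refl) x = begin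
    Fw G w (Fv G v x) v  ≡⟨ Fw-∉ w (Fv G v x) (All¬⇒¬Any v∉w) ⟩
    Fv G v x v           ≡⟨ Fv-self v x ⟩
    F G x v              ≡⟨ F-cong v (sym ∘ seen-head) ⟩
    F G (seen (v ∷ w) x v) v ∎
    where
    seen-head : ∀ u → seen (v ∷ w) x v u ≡ x u
    seen-head u with v ≟ v
    ... | yes _  = refl
    ... | no v≢v = contradiction refl v≢v
  Fw-seen {z ∷ w} {v} (z∉w ∷ unique) (there v∈w) x = begin
    Fw G w (Fv G z x) v           ≡⟨ Fw-seen unique v∈w (Fv G z x) ⟩
    F G (seen w (Fv G z x) v) v   ≡⟨ F-cong v (λ u → seen-tail u (u ≟ z)) ⟩
    F G (seen (z ∷ w) x v) v      ∎
    where
    z∉ : z ∉ w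
    z∉ = All¬⇒¬Any z∉w

    v≢z : v ≢ z
    v≢z refl = z∉ v∈w

    seen-tail : ∀ u → Dec (u ≡ z) → seen w (Fv G z x) v u ≡ seen (z ∷ w) x v u
    seen-tail u (yes refl) = begin
      seen w (Fv G z x) v z ≡⟨ seen-not-before {w} (before-∉ {w = w} z∉) ⟩
      Fv G z x z            ≡⟨ Fw-∉ w (Fv G z x) z∉ ⟨
      Fw G (z ∷ w) x z      ≡⟨ seen-before {z ∷ w} {v = v} (before-head {w = w} v≢z) ⟨
      seen (z ∷ w) x v z    ∎
    seen-tail u (no u≢z) = begin
      seen w (Fv G z x) v u
        ≡⟨ cong (if before w u v then Fw G (z ∷ w) x u else_) (Fv-other x u≢z) ⟩
      (if before w u v then Fw G (z ∷ w) x u else x u)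
        ≡⟨ cong (λ b → if b then Fw G (z ∷ w) x u else x u) (before-cons {w = w} v≢z u≢z) ⟨
      seen (z ∷ w) x v u
        ∎

module OnesExcept {n} (a b : Fin n) where

  ones-except : Config n
  ones-except u = not (⌊ u ≟ a ⌋ ∨ ⌊ u ≟ b ⌋)

  ones-except-≢ : ∀ {u} → u ≢ a → u ≢ b → ones-except u ≡ true
  ones-except-≢ {u} u≢a u≢b with u ≟ a | u ≟ b
  ... | yes u≡a | _       = contradiction u≡a u≢a
  ... | no _    | yes u≡b = contradiction u≡b u≢b
  ... | no _    | no _    = refl

  ones-except-left : ones-except a ≡ false
  ones-except-left with a ≟ a
  ... | yes _   = refl
  ... | no a≢a  = contradiction refl a≢a

  ones-except-right : ones-except b ≡ false
  ones-except-right with b ≟ a | b ≟ b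
  ... | yes _ | _       = refl
  ... | no _  | yes _   = refl
  ... | no _  | no b≢b  = contradiction refl b≢b

module Schedule {n} (G : Graph n) {w : List (Fin n)} (w↭allFin : w ↭ allFin n) where

  scheduled : ∀ v → v ∈ w
  scheduled v = ∈-resp-↭ (↭-sym w↭allFin) (∈-allFin v)

  private
    unique : Unique w
    unique = Unique-resp-↭ (setoid (Fin n)) (↭⇒↭ₛ (↭-sym w↭allFin)) (allFin⁺ n)

    Fw-seen′ : ∀ x v → Fw G w x v ≡ F G (seen G w x v) v
    Fw-seen′ x v = Fw-seen G unique (scheduled v) x

  later-neighbour-kills : ∀ {x u v} → adj G u v ≡ true → before w u v ≡ false →
                          x u ≡ true → Fw G w x v ≡ false
  later-neighbour-kills {x} {u} {v} uv u⊀v xu =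
    trans (Fw-seen′ x v) (F-false G uv (trans (seen-not-before G {w} u⊀v) xu))

  earlier-neighbour-kills : ∀ {x u v} → adj G u v ≡ true → before w u v ≡ true →
                            Fw G w x u ≡ true → Fw G w x v ≡ false
  earlier-neighbour-kills {x} {u} {v} uv u≺v Fw-u =
    trans (Fw-seen′ x v) (F-false G uv (trans (seen-before G {w} u≺v) Fw-u))

  -- a neighbour updated earlier still reads x v = true, so it is switched off
  isolated-one-survives : ∀ {x v} → x v ≡ true → (∀ u → adj G u v ≡ true → x u ≡ false) →
                          Fw G w x v ≡ true
  isolated-one-survives {x} {v} xv neighbours-off = trans (Fw-seen′ x v) (F-true G seen-off)
    where
    seen-off : ∀ u → adj G u v ≡ true → seen G w x v u ≡ false
    seen-off u uv with before w u v in u≺v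
    ... | true  = later-neighbour-kills (trans (adj-sym G v u) uv) (before-asym {w = w} u≺v) xv
    ... | false = neighbours-off u uv

module CycleVertices (m : ℕ) where

  N : ℕ
  N = suc (suc m)

  Cycle-adj-intro : ∀ {u v} → toℕ v ≡ (toℕ u + 1) % N → adj (Cycle m) u v ≡ true
  Cycle-adj-intro {u} {v} v≡u+1 with toℕ v ℕ.≟ (toℕ u + 1) % N
  ... | yes _      = refl
  ... | no v≢u+1  = contradiction v≡u+1 v≢u+1

  Cycle-adj-elim : ∀ {u v} → adj (Cycle m) u v ≡ true →
                   toℕ v ≡ (toℕ u + 1) % N ⊎ toℕ u ≡ (toℕ v + 1) % N
  Cycle-adj-elim {u} {v} uv with toℕ v ℕ.≟ (toℕ u + 1) % N | toℕ u ℕ.≟ (toℕ v + 1) % N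
  ... | yes v≡u+1 | _         = inj₁ v≡u+1
  ... | no _      | yes u≡v+1 = inj₂ u≡v+1
  ... | no _      | no _      = contradiction uv λ ()

  vertex : ℕ → Fin N
  vertex j = fromℕ< (m%n<n j N)

  toℕ-vertex : ∀ j → toℕ (vertex j) ≡ j % N
  toℕ-vertex j = toℕ-fromℕ< (m%n<n j N)

  toℕ-vertex-suc : ∀ j → (toℕ (vertex j) + 1) % N ≡ toℕ (vertex (suc j))
  toℕ-vertex-suc j = begin
    (toℕ (vertex j) + 1) % N  ≡⟨ cong (λ r → (r + 1) % N) (toℕ-vertex j) ⟩
    (j % N + 1) % N           ≡⟨ [m%n+k]%n≡[m+k]%n j 1 N ⟩
    (j + 1) % N               ≡⟨ cong (_% N) (+-comm j 1) ⟩
    suc j % N                 ≡⟨ toℕ-vertex (suc j) ⟨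
    toℕ (vertex (suc j))      ∎

  vertex-periodic : ∀ j → vertex (j + N) ≡ vertex j
  vertex-periodic j = toℕ-injective (begin
    toℕ (vertex (j + N))  ≡⟨ toℕ-vertex (j + N) ⟩
    (j + N) % N           ≡⟨ [m+n]%n≡m%n j N ⟩
    j % N                 ≡⟨ toℕ-vertex j ⟨
    toℕ (vertex j)        ∎)

  vertex-≢ : ∀ c j → 0 < c → c < N → vertex (c + j) ≢ vertex j
  vertex-≢ c j 0<c c<N eq = <-irrefl (sym c≡0) 0<c
    where
    c+j≡j : (c + j) % N ≡ j % N
    c+j≡j = trans (sym (toℕ-vertex (c + j))) (trans (cong toℕ eq) (toℕ-vertex j))

    c≡0 : c ≡ 0
    c≡0 = begin
      c      ≡⟨ m<n⇒m%n≡m c<N ⟨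
      c % N  ≡⟨ %-cancelʳ-+ c 0 j (suc m) c+j≡j ⟩
      0      ∎

  adj-vertex-suc : ∀ j → adj (Cycle m) (vertex j) (vertex (suc j)) ≡ true
  adj-vertex-suc j = Cycle-adj-intro (sym (toℕ-vertex-suc j))

  adj-vertex-pred : ∀ j → adj (Cycle m) (vertex (suc j)) (vertex j) ≡ true
  adj-vertex-pred j = trans (adj-sym (Cycle m) (vertex (suc j)) (vertex j)) (adj-vertex-suc j)

  vertex-neighbours : ∀ j u → adj (Cycle m) u (vertex (suc j)) ≡ true →
                      u ≡ vertex j ⊎ u ≡ vertex (2 + j)
  vertex-neighbours j u uv with Cycle-adj-elim uv
  ... | inj₁ j+1≡u+1 = inj₁ (toℕ-injective (begin
    toℕ u                 ≡⟨ m<n⇒m%n≡m (toℕ<n u) ⟨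
    toℕ u % N             ≡⟨ %-cancelʳ-+ (toℕ u) (toℕ (vertex j)) 1 (suc m)
                               (trans (sym j+1≡u+1) (sym (toℕ-vertex-suc j))) ⟩
    toℕ (vertex j) % N    ≡⟨ m<n⇒m%n≡m (toℕ<n (vertex j)) ⟩
    toℕ (vertex j)        ∎))
  ... | inj₂ u≡j+2 = inj₂ (toℕ-injective (trans u≡j+2 (toℕ-vertex-suc (suc j))))

  on-neighbours : ∀ {A : Set} (y : Fin N → A) {a} j → y (vertex j) ≡ a → y (vertex (2 + j)) ≡ a →
                  ∀ u → adj (Cycle m) u (vertex (suc j)) ≡ true → y u ≡ a
  on-neighbours y j left right u uv with vertex-neighbours j u uv
  ... | inj₁ refl = left
  ... | inj₂ refl = right

  three-zeros-¬IsMIS : ∀ {y} j → y (vertex j) ≡ false → y (vertex (1 + j)) ≡ false →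
                       y (vertex (2 + j)) ≡ false → ¬ IsMIS (Cycle m) y
  three-zeros-¬IsMIS {y} j left middle right =
    ¬IsMIS-undominated (Cycle m) middle (on-neighbours y j left right)

module CycleSchedule (m : ℕ) {w : List (Fin (suc (suc m)))} (permis : IsPermis (Cycle m) w)
                     (5<N : 5 < suc (suc m)) where

  open CycleVertices m public
  open Schedule (Cycle m) (proj₁ permis)

  orientation : ℕ → Bool
  orientation j = before w (vertex j) (vertex (suc j))

  orientation-periodic : ∀ j → orientation (j + N) ≡ orientation j
  orientation-periodic j = cong₂ (before w) (vertex-periodic j) (vertex-periodic (suc j))

  apart : ∀ c j {1≤c : True (1 ≤? c)} {c≤5 : True (c ≤? 5)} → vertex (c + j) ≢ vertex j
  apart c j {1≤c} {c≤5} = vertex-≢ c j (toWitness 1≤c) (≤-<-trans (toWitness c≤5) 5<N)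

  successor-not-first : ∀ j → orientation j ≡ true → before w (vertex (suc j)) (vertex j) ≡ false
  successor-not-first j = before-asym {u = vertex j} {v = vertex (suc j)} {w = w}

  successor-first : ∀ j → orientation j ≡ false → before w (vertex (suc j)) (vertex j) ≡ true
  successor-first j o≡false =
    trans (before-flip {w = w} (apart 1 j) (scheduled (vertex (suc j)))) (cong not o≡false)

  killed-by-successor : ∀ {x} j → orientation j ≡ true → x (vertex (suc j)) ≡ true →
                        Fw (Cycle m) w x (vertex j) ≡ false
  killed-by-successor j o≡true =
    later-neighbour-kills (adj-vertex-pred j) (successor-not-first j o≡true)

  killed-by-predecessor : ∀ {x} j → orientation j ≡ false → x (vertex j) ≡ true →
                          Fw (Cycle m) w x (vertex (suc j)) ≡ false
  killed-by-predecessor j = later-neighbour-kills (adj-vertex-suc j)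

  killed-by-earlier-predecessor : ∀ {x} j → orientation j ≡ true →
                                  Fw (Cycle m) w x (vertex j) ≡ true →
                                  Fw (Cycle m) w x (vertex (suc j)) ≡ false
  killed-by-earlier-predecessor j = earlier-neighbour-kills (adj-vertex-suc j)

  killed-by-earlier-successor : ∀ {x} j → orientation j ≡ false →
                                Fw (Cycle m) w x (vertex (suc j)) ≡ true →
                                Fw (Cycle m) w x (vertex j) ≡ false
  killed-by-earlier-successor j o≡false =
    earlier-neighbour-kills (adj-vertex-pred j) (successor-first j o≡false)

  isolated-one : ∀ {x} j → x (vertex j) ≡ false → x (vertex (1 + j)) ≡ true →
                 x (vertex (2 + j)) ≡ false → Fw (Cycle m) w x (vertex (1 + j)) ≡ true
  isolated-one {x} j left middle right = isolated-one-survives middle (on-neighbours x j left right)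

  no-consecutive-false : ∀ j → orientation j ≡ false → orientation (1 + j) ≡ false → ⊥
  no-consecutive-false j o₀ o₁ with orientation (3 + j) in o₃
  ... | true = three-zeros-¬IsMIS (1 + j)
    (killed-by-predecessor j o₀ refl)
    (killed-by-predecessor (1 + j) o₁ refl)
    (killed-by-successor (3 + j) o₃ refl)
    (proj₂ permis (const true))
  ... | false = three-zeros-¬IsMIS (1 + j)
    (killed-by-predecessor j o₀ (ones-except-≢ (≢-sym (apart 5 j)) (≢-sym (apart 3 j))))
    (killed-by-predecessor (1 + j) o₁ (ones-except-≢ (≢-sym (apart 4 (1 + j))) (≢-sym (apart 2 (1 + j)))))
    (killed-by-earlier-successor (3 + j) o₃ survivor)
    (proj₂ permis ones-except)
    where
    open OnesExcept (vertex (5 + j)) (vertex (3 + j))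

    survivor : Fw (Cycle m) w ones-except (vertex (4 + j)) ≡ true
    survivor = isolated-one (3 + j) ones-except-right
      (ones-except-≢ (≢-sym (apart 1 (4 + j))) (apart 1 (3 + j))) ones-except-left

  -- offset by 3 so that the six vertices involved are j, …, 5 + j, as in no-consecutive-false
  no-consecutive-true : ∀ j → orientation (3 + j) ≡ true → orientation (4 + j) ≡ true → ⊥
  no-consecutive-true j o₃ o₄ with orientation (1 + j) in o₁
  ... | false = three-zeros-¬IsMIS (2 + j)
    (killed-by-predecessor (1 + j) o₁ refl)
    (killed-by-successor (3 + j) o₃ refl)
    (killed-by-successor (4 + j) o₄ refl)
    (proj₂ permis (const true))
  ... | true = three-zeros-¬IsMIS (2 + j)
    (killed-by-earlier-predecessor (1 + j) o₁ survivor)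
    (killed-by-successor (3 + j) o₃ (ones-except-≢ (apart 4 j) (apart 2 (2 + j))))
    (killed-by-successor (4 + j) o₄ (ones-except-≢ (apart 5 j) (apart 3 (2 + j))))
    (proj₂ permis ones-except)
    where
    open OnesExcept (vertex j) (vertex (2 + j))

    survivor : Fw (Cycle m) w ones-except (vertex (1 + j)) ≡ true
    survivor = isolated-one j ones-except-left
      (ones-except-≢ (apart 1 j) (≢-sym (apart 1 (1 + j)))) ones-except-right

  orientation-alternates : ∀ j → orientation (4 + j) ≡ not (orientation (3 + j))
  orientation-alternates j with orientation (3 + j) in o₃ | orientation (4 + j) in o₄
  ... | false | false = ⊥-elim (no-consecutive-false (3 + j) o₃ o₄)
  ... | false | true  = refl
  ... | true  | false = refl
  ... | true  | true  = ⊥-elim (no-consecutive-true j o₃ o₄)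

proposition6p6 : ∀ (k m : ℕ) → 3 ≤ k → suc (suc m) ≡ 2 * k + 1 → ¬ Permissible (Cycle m)
proposition6p6 k m 3≤k N≡2k+1 (w , permis) =
  not-¬ refl (trans (sym wraps-around) (alternating-odd orientation-alternates k))
  where
  N≡1+k+k : suc (suc m) ≡ suc (k + k)
  N≡1+k+k = trans N≡2k+1 (trans (+-comm (2 * k) 1) (cong (λ t → suc (k + t)) (+-identityʳ k)))

  open CycleSchedule m permis (subst (5 <_) (sym N≡1+k+k) (m≤n⇒m≤1+n (+-mono-≤ 3≤k 3≤k)))

  wraps-around : orientation (3 + suc (k + k)) ≡ orientation 3
  wraps-around = subst (λ n → orientation (3 + n) ≡ orientation 3) N≡1+k+k (orientation-periodic 3)
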